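{- Let $(P,\le,*)$ be a relatively pseudocomplemented poset, $a,b\in P$ and $F$ a strong filter of $(P,\le,*)$. Let $\Theta_F$ be the binary relation on $P$ given by $(x,y)\in\Theta_F$ if there exist $c,d\in F$ with $L(x,c,d)=L(y,c,d)$. Then $(a,b)\in\Theta_F$ if and only if $a*b,b*a\in F$.
   Context: For a poset $(P,\le)$ and elements $x_1,\dots,x_n$, $L(x_1,\dots,x_n)=\{z\in P\mid z\le x_i\text{ for all }i\}$. A poset is relatively pseudocomplemented if for all $x,y\in P$ there exists a greatest element $z$ of $P$ such that every element of $L(x,z)$ is $\le y$; this $z$ is denoted $x*y$. A filter of $(P,\le)$ is a nonempty upward closed subset $F$; it is strong if $L(x,y)\cap F\ne\emptyset$ for all $x,y\in F$. A filter of $(P,\le,*)$ is a filter $F$ of $(P,\le)$ with $x*y\in F$ for all $x,y\in F$; a strong filter of $(P,\le,*)$ is a filter of $(P,\le,*)$ that is a strong filter of $(P,\le)$. -}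

module Defs where

open import Level using (Level; _⊔_; suc)
open import Data.Product using (Σ; ∃; ∃-syntax; _×_; _,_)
open import Relation.Binary.Bundles using (Poset)

module _ {c ℓ₁ ℓ₂ : Level} (P : Poset c ℓ₁ ℓ₂) where
  open Poset P

  -- lower cones L(x,y) and L(x,y,z), as predicates on the carrier
  L₂ : Carrier → Carrier → Carrier → Set ℓ₂
  L₂ x y z = (z ≤ x) × (z ≤ y)

  L₃ : Carrier → Carrier → Carrier → Carrier → Set ℓ₂
  L₃ x y w z = (z ≤ x) × (z ≤ y) × (z ≤ w)

  IsRelPseudocomplement : Carrier → Carrier → Carrier → Set (c ⊔ ℓ₂)
  IsRelPseudocomplement x y z =
    (∀ w → L₂ x z w → w ≤ y) ×
    (∀ z′ → (∀ w → L₂ x z′ w → w ≤ y) → z′ ≤ z)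

  record IsRelPseudocomplemented (_*_ : Carrier → Carrier → Carrier) : Set (c ⊔ ℓ₂) where
    field
      isRPC : ∀ x y → IsRelPseudocomplement x y (x * y)

  record IsFilter {ℓ : Level} (F : Carrier → Set ℓ) : Set (c ⊔ ℓ ⊔ ℓ₂) where
    field
      nonempty : ∃[ x ] F x
      upClosed : ∀ {x y} → F x → x ≤ y → F y

  record IsStrongFilter {ℓ : Level} (F : Carrier → Set ℓ) : Set (c ⊔ ℓ ⊔ ℓ₂) where
    field
      isFilter : IsFilter F
      strong   : ∀ {x y} → F x → F y → ∃[ z ] (L₂ x y z × F z)

  module _ (_*_ : Carrier → Carrier → Carrier) where

    record IsStarFilter {ℓ : Level} (F : Carrier → Set ℓ) : Set (c ⊔ ℓ ⊔ ℓ₂) where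
      field
        isFilter : IsFilter F
        *-closed : ∀ {x y} → F x → F y → F (x * y)

    record IsStrongStarFilter {ℓ : Level} (F : Carrier → Set ℓ) : Set (c ⊔ ℓ ⊔ ℓ₂) where
      field
        isStarFilter : IsStarFilter F
        strong       : ∀ {x y} → F x → F y → ∃[ z ] (L₂ x y z × F z)

  _≐_ : {ℓ : Level} → (Carrier → Set ℓ) → (Carrier → Set ℓ) → Set (c ⊔ ℓ)
  A ≐ B = ∀ z → (A z → B z) × (B z → A z)

  Θ : {ℓ : Level} → (Carrier → Set ℓ) → Carrier → Carrier → Set (c ⊔ ℓ ⊔ ℓ₂)
  Θ F x y = ∃[ c′ ] ∃[ d ] (F c′ × F d × (L₃ x c′ d ≐ L₃ y c′ d))

{-# OPTIONS --safe #-}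
-- If L(x,c,d) ⊆ L(y,c,d), every common lower bound e of c and d lies below x * y;
-- a strong filter contains such an e, so it contains x * y.  Conversely
-- c = a * b and d = b * a witness (a,b) ∈ Θ_F by modus ponens w ≤ x, w ≤ x * y ⇒ w ≤ y.

module Submission where

open import Defs
open import Level using (Level)
open import Data.Product using (_×_; _,_; proj₁; proj₂; swap; uncurry)
open import Function.Bundles using (_⇔_; mk⇔)
open import Relation.Binary.Bundles using (Poset)

module _ {c ℓ₁ ℓ₂ : Level} (P : Poset c ℓ₁ ℓ₂) where
  open Poset P

  Θ-sym : ∀ {ℓ} {F : Carrier → Set ℓ} {x y} → Θ P F x y → Θ P F y x
  Θ-sym (c′ , d , Fc , Fd , eq) = c′ , d , Fc , Fd , λ w → swap (eq w)

  isStrongFilter : ∀ {ℓ} {_*_ : Carrier → Carrier → Carrier} {F : Carrier → Set ℓ} →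
                   IsStrongStarFilter P _*_ F → IsStrongFilter P F
  isStrongFilter sf = record
    { isFilter = IsStarFilter.isFilter (IsStrongStarFilter.isStarFilter sf)
    ; strong   = IsStrongStarFilter.strong sf
    }

  module _ {_*_ : Carrier → Carrier → Carrier} (rpc : IsRelPseudocomplemented P _*_) where
    open IsRelPseudocomplemented rpc

    *-modusPonens : ∀ {x y w} → w ≤ x → w ≤ x * y → w ≤ y
    *-modusPonens {x} {y} {w} w≤x w≤x*y = proj₁ (isRPC x y) w (w≤x , w≤x*y)

    *-greatest : ∀ {x y z} → (∀ w → L₂ P x z w → w ≤ y) → z ≤ x * y
    *-greatest {x} {y} {z} = proj₂ (isRPC x y) z

    L₃-⊆⇒lowerBound≤* : ∀ {x y c′ d e} → (∀ w → L₃ P x c′ d w → L₃ P y c′ d w) →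
                        L₂ P c′ d e → e ≤ x * y
    L₃-⊆⇒lowerBound≤* L₃x⊆L₃y (e≤c , e≤d) = *-greatest λ w (w≤x , w≤e) →
      proj₁ (L₃x⊆L₃y w (w≤x , trans w≤e e≤c , trans w≤e e≤d))

    L₃-* : ∀ x y → _≐_ P (L₃ P x (x * y) (y * x)) (L₃ P y (x * y) (y * x))
    L₃-* x y w =
      (λ (w≤x , w≤x*y , w≤y*x) → *-modusPonens w≤x w≤x*y , w≤x*y , w≤y*x) ,
      (λ (w≤y , w≤x*y , w≤y*x) → *-modusPonens w≤y w≤y*x , w≤x*y , w≤y*x)

    Θ⇒* : ∀ {ℓ} {F : Carrier → Set ℓ} → IsStrongFilter P F →
          ∀ {x y} → Θ P F x y → F (x * y)
    Θ⇒* sf (c′ , d , Fc , Fd , eq) with IsStrongFilter.strong sf Fc Fd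
    ... | e , e∈L₂cd , Fe =
      IsFilter.upClosed (IsStrongFilter.isFilter sf) Fe
        (L₃-⊆⇒lowerBound≤* (λ w → proj₁ (eq w)) e∈L₂cd)

    *⇒Θ : ∀ {ℓ} {F : Carrier → Set ℓ} {x y} → F (x * y) → F (y * x) → Θ P F x y
    *⇒Θ {x = x} {y} Fxy Fyx = x * y , y * x , Fxy , Fyx , L₃-* x y

proposition4p13 : {c ℓ₁ ℓ₂ ℓ : Level} (P : Poset c ℓ₁ ℓ₂)
    (_*_ : Poset.Carrier P → Poset.Carrier P → Poset.Carrier P)
    → IsRelPseudocomplemented P _*_
    → (F : Poset.Carrier P → Set ℓ) → IsStrongStarFilter P _*_ F
    → (a b : Poset.Carrier P)
    → Θ P F a b ⇔ (F (a * b) × F (b * a))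
proposition4p13 P _*_ rpc F sf a b = mk⇔
  (λ θ → Θ⇒* P rpc strongF θ , Θ⇒* P rpc strongF (Θ-sym P θ))
  (uncurry (*⇒Θ P rpc))
  where
    strongF : IsStrongFilter P F
    strongF = isStrongFilter P sf
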